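{- Let $S$ be a string of length $n>1$ as described in the context, let $i\in\{0,\dots,n\}$ and $j\in\{0,\dots,i-1\}$. Then $j\in\mathcal{P}_i$ if and only if either $j$ has a last child in the $\mathrm{pss}$-tree and this last child belongs to $\mathcal{P}_i$, or $j=i-1$ and $S_i\prec S_j$.
   Context: $S$ is a string of length $n>1$ over a totally ordered alphabet $\Sigma$, zero-indexed, with $S[n-1]=\$$ and $S[k]>\$$ for all $k<n-1$. $S_i=S[i]\cdots S[n-1]$ ($S_n$ is empty); $\prec$ is the lexicographic order on strings (a proper prefix is smaller). $\mathrm{nss}[j]=\min\{k\in\{j+1,\dots,n\}:S_k\prec S_j\}$ for $0\le j<n$, and $\mathcal{P}_i=\{j\in\{0,\dots,i-1\}:\mathrm{nss}[j]=i\}$. For $0\le k<n$, $\mathrm{pss}[k]=\max(\{j\in\{0,\dots,k-1\}:S_j\prec S_k\}\cup\{ -1\})$. The $\mathrm{pss}$-tree has node set $\{ -1,0,\dots,n-1\}$, root $-1$, and parent of $k\ge0$ equal to $\mathrm{pss}[k]$. If $c_1<\dots<c_k$ are all children of a node, $c_k$ is called its last child. -}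

module Defs where

open import Data.Nat using (ℕ; _<_; _≤_; suc)
open import Data.List using (List; drop)
open import Data.Product using (_×_; ∃)
open import Relation.Binary.PropositionalEquality using (_≡_)
open import Relation.Nullary using (¬_)
open import Data.List.Relation.Binary.Lex.Strict using (Lex-<)

-- Definitions relative to an alphabet A with strict order _⊏_ and a string S
-- of length n (n is the length of S, positions 0..n-1, suffixes S_0..S_n).
module StrDefs {A : Set} (_⊏_ : A → A → Set) (S : List A) (n : ℕ) where

  Suf : ℕ → List A
  Suf i = drop i S

  _≺_ : List A → List A → Set
  _≺_ = Lex-< _≡_ _⊏_

  IsNss : ℕ → ℕ → Set
  IsNss j k = j < k × k ≤ n × (Suf k ≺ Suf j)
              × (∀ m → j < m → m < k → ¬ (Suf m ≺ Suf j))

  InP : ℕ → ℕ → Set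
  InP i j = j < i × IsNss j i

  -- IsChild j k  :  k < n and pss[k] = j for a node j ≥ 0, i.e. j is the
  -- maximum of { j ∈ {0,...,k-1} : S_j ≺ S_k }  (so k is a child of j
  -- in the pss-tree)
  IsChild : ℕ → ℕ → Set
  IsChild j k = k < n × j < k × (Suf j ≺ Suf k)
                × (∀ m → j < m → m < k → ¬ (Suf m ≺ Suf k))

  IsLastChild : ℕ → ℕ → Set
  IsLastChild j c = IsChild j c × (∀ c' → IsChild j c' → c' ≤ c)

{-# OPTIONS --safe #-}
-- If j + 1 < i, let c be the position of the least suffix starting
-- strictly between j and i.  Then S_j ≺ S_c makes c a child of j, leastness of S_c
-- leaves no room for a later child of j, and S_i ≺ S_j ≺ S_c gives nss[c] = i.
-- Conversely, a child c of j with nss[c] = i is exactly that least position, and if c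
-- is the last child then S_i ≺ S_j, for otherwise i would be a later child of j (or
-- i = n, but the empty suffix S_n is the least one).
module Submission where

open import Defs
open import Data.Nat using (ℕ; _<_; _≤_; suc; _∸_)
open import Data.Nat.Properties
  using (<-cmp; <-trans; <-≤-trans; <⇒≤; <⇒≢; >⇒≢; <⇒≱; ≮⇒≥; ≤-refl; ≤-reflexive;
         ≤-pred; ≤-antisym; m<1+n⇒m≤n; m<1+n⇒m<n∨m≡n; m≤n⇒m<n∨m≡n; m∸[m∸n]≡n;
         n∸n≡0; m<n⇒0<n∸m)
open import Data.List using (List; []; _∷_; length; _++_; [_])
open import Data.List.Properties using (length-drop)
open import Data.List.Relation.Unary.All using (All)
open import Data.List.Relation.Binary.Pointwise using (Pointwise-≡⇒≡)
open import Data.List.Relation.Binary.Lex.Strict using (<-isStrictTotalOrder; halt)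
open import Data.Product using (_×_; ∃; _,_)
open import Data.Sum using (_⊎_; inj₁; inj₂)
open import Data.Empty using (⊥-elim)
open import Function.Bundles using (_⇔_; mk⇔)
open import Relation.Nullary using (¬_)
open import Relation.Binary.PropositionalEquality
  using (_≡_; _≢_; refl; sym; trans; cong; module ≡-Reasoning)
open import Relation.Binary.Structures using (IsStrictTotalOrder)
open import Relation.Binary.Definitions using (tri<; tri≈; tri>)

module SuffixOrder {A : Set} (_⊏_ : A → A → Set) (⊏-sto : IsStrictTotalOrder _≡_ _⊏_)
                   (S : List A) (n : ℕ) (length-S : length S ≡ n) where
  open StrDefs _⊏_ S n
  private module Lex = IsStrictTotalOrder (<-isStrictTotalOrder {_≈_ = _≡_} ⊏-sto)

  ≺-trans : ∀ {xs ys zs} → xs ≺ ys → ys ≺ zs → xs ≺ zs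
  ≺-trans = Lex.trans

  ≺-asym : ∀ {xs ys} → xs ≺ ys → ¬ ys ≺ xs
  ≺-asym = Lex.asym

  length-Suf : ∀ p → length (Suf p) ≡ n ∸ p
  length-Suf p = trans (length-drop p S) (cong (_∸ p) length-S)

  Suf-injective : ∀ {p q} → p ≤ n → q ≤ n → Suf p ≡ Suf q → p ≡ q
  Suf-injective {p} {q} p≤n q≤n eq = begin
    p                  ≡⟨ m∸[m∸n]≡n p≤n ⟨
    n ∸ (n ∸ p)        ≡⟨ cong (n ∸_) (length-Suf p) ⟨
    n ∸ length (Suf p) ≡⟨ cong (λ xs → n ∸ length xs) eq ⟩
    n ∸ length (Suf q) ≡⟨ cong (n ∸_) (length-Suf q) ⟩
    n ∸ (n ∸ q)        ≡⟨ m∸[m∸n]≡n q≤n ⟩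
    q                  ∎
    where open ≡-Reasoning

  Suf-connex : ∀ {p q} → p ≤ n → q ≤ n → p ≢ q → Suf p ≺ Suf q ⊎ Suf q ≺ Suf p
  Suf-connex {p} {q} p≤n q≤n p≢q with Lex.compare (Suf p) (Suf q)
  ... | tri< p≺q _ _ = inj₁ p≺q
  ... | tri≈ _ p≈q _ = ⊥-elim (p≢q (Suf-injective p≤n q≤n (Pointwise-≡⇒≡ p≈q)))
  ... | tri> _ _ q≺p = inj₂ q≺p

  Suf-≺-from-⊀ : ∀ {p q} → p ≤ n → q ≤ n → p ≢ q → ¬ Suf q ≺ Suf p → Suf p ≺ Suf q
  Suf-≺-from-⊀ p≤n q≤n p≢q q⊀p with Suf-connex p≤n q≤n p≢q
  ... | inj₁ p≺q = p≺q
  ... | inj₂ q≺p = ⊥-elim (q⊀p q≺p)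

  Suf-n-≺ : ∀ {j} → j < n → Suf n ≺ Suf j
  Suf-n-≺ {j} j<n = empty-≺ (trans (length-Suf n) (n∸n≡0 n))
                            (<-≤-trans (m<n⇒0<n∸m j<n) (≤-reflexive (sym (length-Suf j))))
    where
      empty-≺ : ∀ {xs ys : List A} → length xs ≡ 0 → 0 < length ys → xs ≺ ys
      empty-≺ {[]} {_ ∷ _} _ _ = halt

  LeastBetween : ℕ → ℕ → ℕ → Set
  LeastBetween a b c = a < c × c < b × (∀ m → a < m → m < b → m ≡ c ⊎ Suf c ≺ Suf m)

  least-minimal : ∀ {a b c m} → LeastBetween a b c → a < m → m < b → ¬ Suf m ≺ Suf c
  least-minimal (_ , _ , least) a<m m<b m≺c with least _ a<m m<b
  ... | inj₁ refl = ≺-asym m≺c m≺c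
  ... | inj₂ c≺m = ≺-asym c≺m m≺c

  below-least : ∀ {a b c x m} → LeastBetween a b c → Suf x ≺ Suf c →
                a < m → m < b → ¬ Suf m ≺ Suf x
  below-least l x≺c a<m m<b m≺x = least-minimal l a<m m<b (≺-trans m≺x x≺c)

  least-singleton : ∀ a → LeastBetween a (suc (suc a)) (suc a)
  least-singleton a = ≤-refl , ≤-refl , λ m a<m m<b → inj₁ (≤-antisym (m<1+n⇒m≤n m<b) a<m)

  least-extend : ∀ {a b c} → LeastBetween a b c → b < n → ∃ (LeastBetween a (suc b))
  least-extend {a} {b} {c} (a<c , c<b , least) b<n
    with Suf-connex (<⇒≤ (<-trans c<b b<n)) (<⇒≤ b<n) (<⇒≢ c<b)
  ... | inj₁ c≺b = c , a<c , <-trans c<b ≤-refl , least′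
    where
      least′ : ∀ m → a < m → m < suc b → m ≡ c ⊎ Suf c ≺ Suf m
      least′ m a<m m<1+b with m<1+n⇒m<n∨m≡n m<1+b
      ... | inj₁ m<b = least m a<m m<b
      ... | inj₂ refl = inj₂ c≺b
  ... | inj₂ b≺c = b , <-trans a<c c<b , ≤-refl , least′
    where
      least′ : ∀ m → a < m → m < suc b → m ≡ b ⊎ Suf b ≺ Suf m
      least′ m a<m m<1+b with m<1+n⇒m<n∨m≡n m<1+b
      ... | inj₂ m≡b = inj₁ m≡b
      ... | inj₁ m<b with least m a<m m<b
      ...   | inj₁ refl = inj₂ b≺c
      ...   | inj₂ c≺m = inj₂ (≺-trans b≺c c≺m)

  least-exists : ∀ {a b} → suc a < b → b ≤ n → ∃ (LeastBetween a b)
  least-exists {a} {suc b} 1+a<1+b 1+b≤n with m≤n⇒m<n∨m≡n (≤-pred 1+a<1+b)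
  ... | inj₂ refl = suc a , least-singleton a
  ... | inj₁ 1+a<b with least-exists 1+a<b (<⇒≤ 1+b≤n)
  ...   | _ , least = least-extend least 1+b≤n

  least⇒IsNss : ∀ {a b c} → LeastBetween a b c → b ≤ n → Suf b ≺ Suf c → IsNss c b
  least⇒IsNss l@(a<c , c<b , _) b≤n b≺c =
    c<b , b≤n , b≺c , λ m c<m m<b → least-minimal l (<-trans a<c c<m) m<b

  least⇒IsChild : ∀ {a b c} → LeastBetween a b c → b ≤ n → Suf a ≺ Suf c → IsChild a c
  least⇒IsChild l@(a<c , c<b , _) b≤n a≺c =
    <-≤-trans c<b b≤n , a<c , a≺c , λ m a<m m<c → least-minimal l a<m (<-trans m<c c<b)

  below-least⇒IsNss : ∀ {a b c} → LeastBetween a b c → b ≤ n →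
                      Suf b ≺ Suf a → Suf a ≺ Suf c → IsNss a b
  below-least⇒IsNss {a} l@(a<c , c<b , _) b≤n b≺a a≺c =
    <-trans a<c c<b , b≤n , b≺a , λ m → below-least {x = a} l a≺c

  below-least⇒IsChild : ∀ {a b c} → LeastBetween a b c → b < n →
                        Suf a ≺ Suf b → Suf b ≺ Suf c → IsChild a b
  below-least⇒IsChild {b = b} l@(a<c , c<b , _) b<n a≺b b≺c =
    b<n , <-trans a<c c<b , a≺b , λ m → below-least {x = b} l b≺c

  child-nss⇒least : ∀ {a b c} → IsChild a c → IsNss c b → LeastBetween a b c
  child-nss⇒least {a} {b} {c} (c<n , a<c , _ , m⊀c) (c<b , b≤n , _ , m⊀c′) =
    a<c , c<b , least
    where
      least : ∀ m → a < m → m < b → m ≡ c ⊎ Suf c ≺ Suf m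
      least m a<m m<b with <-cmp m c
      ... | tri< m<c _ _ = inj₂ (Suf-≺-from-⊀ (<⇒≤ c<n) (<⇒≤ (<-trans m<c c<n)) (>⇒≢ m<c)
                                             (m⊀c m a<m m<c))
      ... | tri≈ _ m≡c _ = inj₁ m≡c
      ... | tri> _ _ c<m = inj₂ (Suf-≺-from-⊀ (<⇒≤ c<n) (<⇒≤ (<-≤-trans m<b b≤n)) (<⇒≢ c<m)
                                             (m⊀c′ m c<m m<b))

  nss-least⇒last : ∀ {a b c} → IsNss a b → LeastBetween a b c →
                   ∀ c′ → IsChild a c′ → c′ ≤ c
  nss-least⇒last {a} {b} {c} (a<b , _ , b≺a , _) (a<c , _ , least)
                 c′ (_ , a<c′ , a≺c′ , m⊀c′) = ≮⇒≥ no-later-child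
    where
      no-later-child : ¬ c < c′
      no-later-child c<c′ with <-cmp c′ b
      ... | tri< c′<b _ _ with least c′ a<c′ c′<b
      ...   | inj₁ refl = <⇒≢ c<c′ refl
      ...   | inj₂ c≺c′ = m⊀c′ c a<c c<c′ c≺c′
      no-later-child c<c′ | tri≈ _ refl _ = ≺-asym a≺c′ b≺a
      no-later-child c<c′ | tri> _ _ b<c′ = m⊀c′ b a<b b<c′ (≺-trans b≺a a≺c′)

  IsNss-pred : ∀ {i j} → j < i → i ≤ n → j ≡ i ∸ 1 → Suf i ≺ Suf j → IsNss j i
  IsNss-pred {suc i} _ i<n refl i≺j =
    ≤-refl , i<n , i≺j , λ m i<m m<1+i _ → <⇒≱ i<m (m<1+n⇒m≤n m<1+i)

  lastChild-nss⇒≺ : ∀ {i j c} → j < i → i ≤ n → IsLastChild j c → IsNss c i → Suf i ≺ Suf j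
  lastChild-nss⇒≺ {i} {j} {c} j<i i≤n (child , last) nss@(c<i , _ , i≺c , _) =
    Suf-≺-from-⊀ i≤n (<⇒≤ (<-≤-trans j<i i≤n)) (>⇒≢ j<i) j⊀i
    where
      j⊀i : ¬ Suf j ≺ Suf i
      j⊀i j≺i with m≤n⇒m<n∨m≡n i≤n
      ... | inj₁ i<n =
        <⇒≱ c<i (last i (below-least⇒IsChild (child-nss⇒least child nss) i<n j≺i i≺c))
      ... | inj₂ refl = ≺-asym j≺i (Suf-n-≺ j<i)

  InP-characterisation : ∀ {i j} → i ≤ n → j < i →
    InP i j ⇔ ((∃ λ c → IsLastChild j c × InP i c) ⊎ (j ≡ i ∸ 1 × Suf i ≺ Suf j))
  InP-characterisation {i} {j} i≤n j<i = mk⇔ forward backward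
    where
      forward : InP i j → (∃ λ c → IsLastChild j c × InP i c) ⊎ (j ≡ i ∸ 1 × Suf i ≺ Suf j)
      forward (_ , nss@(_ , _ , i≺j , m⊀j)) with m≤n⇒m<n∨m≡n j<i
      ... | inj₂ refl = inj₂ (refl , i≺j)
      ... | inj₁ 1+j<i with least-exists 1+j<i i≤n
      ...   | c , l@(j<c , c<i , _) =
        inj₁ (c , (least⇒IsChild l i≤n j≺c , nss-least⇒last nss l) ,
              c<i , least⇒IsNss l i≤n (≺-trans i≺j j≺c))
        where
          j≺c : Suf j ≺ Suf c
          j≺c = Suf-≺-from-⊀ (<⇒≤ (<-≤-trans j<i i≤n)) (<⇒≤ (<-≤-trans c<i i≤n))
                             (<⇒≢ j<c) (m⊀j c j<c c<i)
      backward : (∃ λ c → IsLastChild j c × InP i c) ⊎ (j ≡ i ∸ 1 × Suf i ≺ Suf j) → InP i j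
      backward (inj₂ (j≡i-1 , i≺j)) = j<i , IsNss-pred j<i i≤n j≡i-1 i≺j
      backward (inj₁ (c , last@(child@(_ , _ , j≺c , _) , _) , _ , nss)) =
        j<i , below-least⇒IsNss (child-nss⇒least child nss) i≤n
                                (lastChild-nss⇒≺ j<i i≤n last nss) j≺c

lemma3 : {A : Set} (_⊏_ : A → A → Set) → IsStrictTotalOrder _≡_ _⊏_ →
    (dollar : A) (T : List A) → All (dollar ⊏_) T →
    (S : List A) → S ≡ T ++ [ dollar ] →
    (n : ℕ) → length S ≡ n → 1 < n →
    (i j : ℕ) → i ≤ n → j < i →
    StrDefs.InP _⊏_ S n i j
    ⇔ ((∃ λ c → StrDefs.IsLastChild _⊏_ S n j c × StrDefs.InP _⊏_ S n i c)
    ⊎ (j ≡ i ∸ 1 × StrDefs._≺_ _⊏_ S n (StrDefs.Suf _⊏_ S n i) (StrDefs.Suf _⊏_ S n j)))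
lemma3 _⊏_ ⊏-sto _ _ _ S _ n length-S _ i j i≤n j<i =
  SuffixOrder.InP-characterisation _⊏_ ⊏-sto S n length-S i≤n j<i
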